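{- Let $\mathbf L$ be any substructural logic with $\mathbf{FL}_{\mathbf e}\subseteq\mathbf L\subseteq\mathbf{IPL}$, and let $\varphi\Rightarrow_{\wedge}\psi:=(\varphi\to\psi)\wedge(\psi\to\neg\neg\varphi)$. The following are equivalent: (1) $(\mathbf L,\Rightarrow_{\wedge})$ is a connexive logic; (2) $(\mathbf L,\Rightarrow_{\wedge})$ is a proto-connexive logic; (3) at least one of Boethius' theses $(\varphi\Rightarrow_{\wedge}\psi)\Rightarrow_{\wedge}\neg(\varphi\Rightarrow_{\wedge}\neg\psi)$, $(\varphi\Rightarrow_{\wedge}\neg\psi)\Rightarrow_{\wedge}\neg(\varphi\Rightarrow_{\wedge}\psi)$ is a theorem (for all formulas $\varphi,\psi$) of $\mathbf L$; (4) $\mathbf L$ is an axiomatic extension of $\mathbf G_{\mathbf{FL}_{\mathbf e}}(\mathbf{CPL})$. The same holds for $\varphi\Rightarrow_{\circ}\psi:=(\varphi\to\psi)\cdot(\psi\to\neg\neg\varphi)$ in place of $\Rightarrow_{\wedge}$, provided it is further assumed that $\varphi\to\neg\neg 1$ is a theorem of $\mathbf L$ for every formula $\varphi$.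
   Context: Formulas are built from variables in the language $\{\wedge,\vee,\cdot,\to,0,1\}$; $\neg\varphi:=\varphi\to 0$. $\mathbf{FL}_{\mathbf e}$ is the (external) logic of the Full Lambek calculus with exchange; substructural logics are its axiomatic extensions. An FL${}_{\mathrm e}$-algebra is an algebra $\langle A,\wedge,\vee,\cdot,\to,0,1\rangle$ with a lattice reduct (order $\leq$), commutative monoid reduct $\langle A,\cdot,1\rangle$, arbitrary constant $0$, and $x\cdot y\leq z\iff x\leq y\to z$. Each substructural logic $\mathbf L$ is algebraizable with equivalent algebraic semantics the variety $\mathsf V(\mathbf L)$ of FL${}_{\mathrm e}$-algebras, where $\vdash_{\mathbf L}\varphi$ iff $\mathsf V(\mathbf L)\models 1\leq\varphi$; this is a dual isomorphism between substructural logics and subvarieties. $\mathbf{IPL}$ (intuitionistic logic) corresponds to Heyting algebras and $\mathbf{CPL}$ (classical logic) to Boolean algebras. $\mathbf G_{\mathbf{FL}_{\mathbf e}}(\mathbf{CPL})$ is the least substructural logic $\mathbf K$ such that for every formula $\varphi$, $\vdash_{\mathbf{CPL}}\varphi$ iff $\vdash_{\mathbf K}\neg\neg\varphi$. For a term-defined binary connective ${\Rightarrow}$: an FL${}_{\mathrm e}$-algebra is proto-connexive for ${\Rightarrow}$ if it satisfies, for all $x,y$, $1\leq\neg(x{\Rightarrow}\neg x)$, $1\leq\neg(\neg x{\Rightarrow} x)$, $1\leq (x{\Rightarrow} y){\Rightarrow}\neg(x{\Rightarrow}\neg y)$, $1\leq (x{\Rightarrow}\neg y){\Rightarrow}\neg(x{\Rightarrow}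 y)$; $(\mathbf L,{\Rightarrow})$ is proto-connexive if every member of $\mathsf V(\mathbf L)$ is, and connexive if moreover some member of $\mathsf V(\mathbf L)$ has elements $x,y$ with $x{\Rightarrow} y\neq y{\Rightarrow} x$. -}

module Defs where

open import Data.Nat using (ℕ)
open import Data.Product using (Σ; ∃; ∃-syntax; _×_)
open import Data.Sum using (_⊎_)
open import Relation.Binary.PropositionalEquality using (_≡_; _≢_)
open import Function.Bundles using (_⇔_)

infixr 5 _⟶ᶠ_
infixl 6 _∧ᶠ_ _∨ᶠ_ _·ᶠ_

data Formula : Set where
  var   : ℕ → Formula
  _∧ᶠ_  : Formula → Formula → Formula
  _∨ᶠ_  : Formula → Formula → Formula
  _·ᶠ_  : Formula → Formula → Formula
  _⟶ᶠ_  : Formula → Formula → Formula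
  𝟘ᶠ    : Formula
  𝟙ᶠ    : Formula

infix 8 ¬ᶠ_
¬ᶠ_ : Formula → Formula
¬ᶠ φ = φ ⟶ᶠ 𝟘ᶠ

record FLe : Set₁ where
  infixl 6 _⊓_ _⊔_ _∙_
  infixr 5 _↝_
  field
    Carrier : Set
    _⊓_ _⊔_ _∙_ _↝_ : Carrier → Carrier → Carrier
    zero one : Carrier
    ⊓-comm  : ∀ x y → x ⊓ y ≡ y ⊓ x
    ⊔-comm  : ∀ x y → x ⊔ y ≡ y ⊔ x
    ⊓-assoc : ∀ x y z → (x ⊓ y) ⊓ z ≡ x ⊓ (y ⊓ z)
    ⊔-assoc : ∀ x y z → (x ⊔ y) ⊔ z ≡ x ⊔ (y ⊔ z)
    ⊓-absorbs-⊔ : ∀ x y → x ⊓ (x ⊔ y) ≡ x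
    ⊔-absorbs-⊓ : ∀ x y → x ⊔ (x ⊓ y) ≡ x
    ∙-assoc : ∀ x y z → (x ∙ y) ∙ z ≡ x ∙ (y ∙ z)
    ∙-comm  : ∀ x y → x ∙ y ≡ y ∙ x
    ∙-identityˡ : ∀ x → one ∙ x ≡ x

  _≤_ : Carrier → Carrier → Set
  x ≤ y = x ⊓ y ≡ x

  field
    residuated : ∀ x y z → ((x ∙ y) ≤ z) ⇔ (x ≤ (y ↝ z))

  ∼_ : Carrier → Carrier
  ∼ x = x ↝ zero

open FLe public

⟦_⟧ : Formula → (A : FLe) → (ℕ → Carrier A) → Carrier A
⟦ var n ⟧   A v = v n
⟦ φ ∧ᶠ ψ ⟧ A v = _⊓_ A (⟦ φ ⟧ A v) (⟦ ψ ⟧ A v)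
⟦ φ ∨ᶠ ψ ⟧ A v = _⊔_ A (⟦ φ ⟧ A v) (⟦ ψ ⟧ A v)
⟦ φ ·ᶠ ψ ⟧ A v = _∙_ A (⟦ φ ⟧ A v) (⟦ ψ ⟧ A v)
⟦ φ ⟶ᶠ ψ ⟧ A v = _↝_ A (⟦ φ ⟧ A v) (⟦ ψ ⟧ A v)
⟦ 𝟘ᶠ ⟧      A v = zero A
⟦ 𝟙ᶠ ⟧      A v = one A

Valid : FLe → Formula → Set
Valid A φ = ∀ (v : ℕ → Carrier A) → _≤_ A (one A) (⟦ φ ⟧ A v)

-- Substructural logics: axiomatic extensions of FLe, given by a set of
-- axioms Γ.  V(L) = FLe-algebras validating the axioms; by
-- algebraizability ⊢_L φ iff V(L) ⊨ 1 ≤ φ.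

Axioms : Set₁
Axioms = Formula → Set

InV : Axioms → FLe → Set
InV Γ A = ∀ φ → Γ φ → Valid A φ

⊢[_]_ : Axioms → Formula → Set₁
⊢[ Γ ] φ = ∀ (A : FLe) → InV Γ A → Valid A φ

_⊆ᴸ_ : Axioms → Axioms → Set₁
Γ ⊆ᴸ Δ = ∀ φ → ⊢[ Γ ] φ → ⊢[ Δ ] φ

IsHeyting : FLe → Set
IsHeyting A = (∀ x y → _∙_ A x y ≡ _⊓_ A x y) × (∀ x → _≤_ A (zero A) x)

IsBoolean : FLe → Set
IsBoolean A = IsHeyting A × (∀ x → _⊔_ A x (∼_ A x) ≡ one A)

⊢IPL_ : Formula → Set₁
⊢IPL φ = ∀ (A : FLe) → IsHeyting A → Valid A φ

⊢CPL_ : Formula → Set₁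
⊢CPL φ = ∀ (A : FLe) → IsBoolean A → Valid A φ

⊆IPL : Axioms → Set₁
⊆IPL Γ = ∀ φ → ⊢[ Γ ] φ → ⊢IPL φ

GlivenkoCPL : Axioms → Set₁
GlivenkoCPL K = ∀ φ → (⊢CPL φ) ⇔ (⊢[ K ] (¬ᶠ (¬ᶠ φ)))

-- Γ axiomatizes G_FLe(CPL): the least substructural logic with the
-- Glivenko property
IsGlivenkoCPL : Axioms → Set₁
IsGlivenkoCPL G = GlivenkoCPL G × (∀ (K : Axioms) → GlivenkoCPL K → G ⊆ᴸ K)

ExtendsGCPL : Axioms → Set₁
ExtendsGCPL L = Σ Axioms (λ G → IsGlivenkoCPL G × (G ⊆ᴸ L))

data Conn : Set where
  wedge circ : Conn

infixr 4 _⇒[_]_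
_⇒[_]_ : Formula → Conn → Formula → Formula
φ ⇒[ wedge ] ψ = (φ ⟶ᶠ ψ) ∧ᶠ (ψ ⟶ᶠ ¬ᶠ (¬ᶠ φ))
φ ⇒[ circ ]  ψ = (φ ⟶ᶠ ψ) ·ᶠ (ψ ⟶ᶠ ¬ᶠ (¬ᶠ φ))

op : Conn → (A : FLe) → Carrier A → Carrier A → Carrier A
op wedge A x y = _⊓_ A (_↝_ A x y) (_↝_ A y (∼_ A (∼_ A x)))
op circ  A x y = _∙_ A (_↝_ A x y) (_↝_ A y (∼_ A (∼_ A x)))

ProtoConnAlg : (A : FLe) → (Carrier A → Carrier A → Carrier A) → Set
ProtoConnAlg A _⇛_ =
  (∀ x → le (one A) (neg (x ⇛ neg x))) ×
  (∀ x → le (one A) (neg (neg x ⇛ x))) ×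
  (∀ x y → le (one A) ((x ⇛ y) ⇛ neg (x ⇛ neg y))) ×
  (∀ x y → le (one A) ((x ⇛ neg y) ⇛ neg (x ⇛ y)))
  where
  le = _≤_ A
  neg = ∼_ A

ProtoConnexive : Axioms → Conn → Set₁
ProtoConnexive L c = ∀ (A : FLe) → InV L A → ProtoConnAlg A (op c A)

Connexive : Axioms → Conn → Set₁
Connexive L c = ProtoConnexive L c ×
  Σ FLe (λ A → InV L A × ∃[ x ] ∃[ y ] (op c A x y ≢ op c A y x))

Boethius : Axioms → Conn → Set₁
Boethius L c =
  (∀ φ ψ → ⊢[ L ] ((φ ⇒[ c ] ψ) ⇒[ c ] ¬ᶠ (φ ⇒[ c ] ¬ᶠ ψ))) ⊎
  (∀ φ ψ → ⊢[ L ] ((φ ⇒[ c ] ¬ᶠ ψ) ⇒[ c ] ¬ᶠ (φ ⇒[ c ] ψ)))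

TFAE : Axioms → Conn → Set₁
TFAE L c = (Connexive L c ⇔ ExtendsGCPL L)
         × (ProtoConnexive L c ⇔ ExtendsGCPL L)
         × (Boethius L c ⇔ ExtendsGCPL L)

-- Call an FLe-algebra Glivenko when 1 ≤ ¬¬ψ holds in it for every classical
-- tautology ψ.  The logic axiomatised by the double negations of the classical
-- tautologies is G_FLe(CPL), so (4) says that every member of V(L) is Glivenko.
-- Glivenko algebras are proto-connexive, since each of the four conditions is,
-- up to ¬¬¬ = ¬, a double-negated tautology; and proto-connexivity contains the
-- first Boethius thesis.  Conversely, a Boethius thesis makes x ⇒ y and x ⇒ ¬y
-- contradictories: both their product and the product of their negations lie
-- below 0.  Together with x·0 ≤ 0 (which the thesis itself yields for ⇒∧, and
-- φ → ¬¬1 yields for ⇒∘) this gives x ≤ ¬¬(x·x) and 1 ≤ ¬¬(¬¬x → x), and under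
-- these three conditions Kalmár's lemma, with ¬¬x and ¬x as literals, shows that
-- the algebra is Glivenko.  Connexivity then comes for free: the three-element
-- Gödel chain lies in V(L) because L ⊆ IPL, and there ⇒ is not symmetric.

module Submission where

open import Defs hiding
  ( _⊓_; _⊔_; _∙_; _↝_; zero; one; _≤_; ∼_; residuated
  ; ⊓-comm; ⊔-comm; ⊓-assoc; ⊔-assoc; ⊓-absorbs-⊔; ⊔-absorbs-⊓
  ; ∙-assoc; ∙-comm; ∙-identityˡ )
open import Algebra.Bundles using (CommutativeSemigroup)
open import Data.Bool using (Bool; true; false; _∧_; _∨_)
open import Data.Bool.Properties as Bool using ()
open import Data.Empty using (⊥-elim)
open import Data.List using (List; []; _∷_; _++_)
open import Data.List.Membership.Propositional using (_∈_; _∉_)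
open import Data.List.Membership.Propositional.Properties using (∈-++⁺ˡ; ∈-++⁺ʳ)
open import Data.List.Relation.Unary.Any using (here; there)
open import Data.Nat using (ℕ; suc)
open import Data.Nat.Properties using (_≟_)
open import Data.Product using (Σ; ∃-syntax; _×_; _,_; proj₁; proj₂)
open import Data.Sum as Sum using (_⊎_; inj₁; inj₂)
open import Function using (_∘_; id)
open import Function.Bundles using (_⇔_; mk⇔; Equivalence)
open import Relation.Binary.Bundles using (Poset)
import Relation.Binary.Reasoning.PartialOrder as PartialOrderReasoning
open import Relation.Binary.PropositionalEquality
  using (_≡_; _≢_; refl; sym; trans; cong; cong₂; subst; subst₂; isEquivalence)
open import Relation.Nullary using (yes; no)

-- Classical tautologies

_→ᵇ_ : Bool → Bool → Bool
true  →ᵇ y = y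
false →ᵇ _ = true

B₂ : FLe
B₂ = record
  { Carrier = Bool
  ; _⊓_ = _∧_ ; _⊔_ = _∨_ ; _∙_ = _∧_ ; _↝_ = _→ᵇ_ ; zero = false ; one = true
  ; ⊓-comm = Bool.∧-comm ; ⊔-comm = Bool.∨-comm ; ⊓-assoc = Bool.∧-assoc ; ⊔-assoc = Bool.∨-assoc
  ; ⊓-absorbs-⊔ = Bool.∧-abs-∨ ; ⊔-absorbs-⊓ = Bool.∨-abs-∧
  ; ∙-assoc = Bool.∧-assoc ; ∙-comm = Bool.∧-comm ; ∙-identityˡ = Bool.∧-identityˡ
  ; residuated = residuated
  }
  where
  residuated : ∀ x y z → ((x ∧ y) ∧ z ≡ x ∧ y) ⇔ (x ∧ (y →ᵇ z) ≡ x)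
  residuated false y     z = mk⇔ (λ _ → refl) (λ _ → refl)
  residuated true  false z = mk⇔ (λ _ → refl) (λ _ → refl)
  residuated true  true  z = mk⇔ id id

B₂-isBoolean : IsBoolean B₂
B₂-isBoolean = ((λ _ _ → refl) , λ _ → refl) , λ { false → refl ; true → refl }

Tautology : Formula → Set
Tautology ψ = ∀ b → ⟦ ψ ⟧ B₂ b ≡ true

SatisfiesGlivenko : FLe → Set
SatisfiesGlivenko A = ∀ ψ → Tautology ψ → Valid A (¬ᶠ (¬ᶠ ψ))

vars : Formula → List ℕ
vars (var n)  = n ∷ []
vars (φ ∧ᶠ ψ) = vars φ ++ vars ψ
vars (φ ∨ᶠ ψ) = vars φ ++ vars ψ
vars (φ ·ᶠ ψ) = vars φ ++ vars ψ
vars (φ ⟶ᶠ ψ) = vars φ ++ vars ψ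
vars 𝟘ᶠ       = []
vars 𝟙ᶠ       = []

update : (ℕ → Bool) → ℕ → Bool → ℕ → Bool
update b n s m with m ≟ n
... | yes _ = s
... | no  _ = b m

-- Arithmetic of FLe-algebras

module FLeProperties (A : FLe) where

  open FLe A public hiding (Carrier) renaming (_≤_ to infix 4 _≤_; zero to 𝟎; one to 𝟏)

  ⊓-idem : ∀ x → x ⊓ x ≡ x
  ⊓-idem x = trans (cong (x ⊓_) (sym (⊔-absorbs-⊓ x x))) (⊓-absorbs-⊔ x (x ⊓ x))

  ≤-refl : ∀ {x} → x ≤ x
  ≤-refl {x} = ⊓-idem x

  ≤-reflexive : ∀ {x y} → x ≡ y → x ≤ y
  ≤-reflexive refl = ≤-refl

  ≤-trans : ∀ {x y z} → x ≤ y → y ≤ z → x ≤ z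
  ≤-trans {x} {y} {z} x≤y y≤z =
    trans (cong (_⊓ z) (sym x≤y)) (trans (⊓-assoc x y z) (trans (cong (x ⊓_) y≤z) x≤y))

  ≤-antisym : ∀ {x y} → x ≤ y → y ≤ x → x ≡ y
  ≤-antisym {x} {y} x≤y y≤x = trans (sym x≤y) (trans (⊓-comm x y) y≤x)

  poset : Poset _ _ _
  poset = record
    { Carrier = Carrier A
    ; _≈_ = _≡_
    ; _≤_ = _≤_
    ; isPartialOrder = record
      { isPreorder = record
        { isEquivalence = isEquivalence
        ; reflexive = ≤-reflexive
        ; trans = ≤-trans
        }
      ; antisym = ≤-antisym
      }
    }

  open PartialOrderReasoning poset public

  x⊓y≤x : ∀ {x y} → x ⊓ y ≤ x
  x⊓y≤x {x} {y} = begin-equality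
    x ⊓ y ⊓ x   ≡⟨ ⊓-assoc x y x ⟩
    x ⊓ (y ⊓ x) ≡⟨ cong (x ⊓_) (⊓-comm y x) ⟩
    x ⊓ (x ⊓ y) ≡⟨ ⊓-assoc x x y ⟨
    x ⊓ x ⊓ y   ≡⟨ cong (_⊓ y) (⊓-idem x) ⟩
    x ⊓ y       ∎

  x⊓y≤y : ∀ {x y} → x ⊓ y ≤ y
  x⊓y≤y {x} {y} = trans (⊓-assoc x y y) (cong (x ⊓_) (⊓-idem y))

  ⊓-greatest : ∀ {x y z} → x ≤ y → x ≤ z → x ≤ y ⊓ z
  ⊓-greatest {x} {y} {z} x≤y x≤z = trans (sym (⊓-assoc x y z)) (trans (cong (_⊓ z) x≤y) x≤z)

  x≤x⊔y : ∀ {x y} → x ≤ x ⊔ y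
  x≤x⊔y {x} {y} = ⊓-absorbs-⊔ x y

  y≤x⊔y : ∀ {x y} → y ≤ x ⊔ y
  y≤x⊔y {x} {y} = trans (cong (y ⊓_) (⊔-comm x y)) (⊓-absorbs-⊔ y x)

  ≤⇒⊔≡ : ∀ {x y} → x ≤ y → x ⊔ y ≡ y
  ≤⇒⊔≡ {x} {y} x≤y = begin-equality
    x ⊔ y       ≡⟨ cong (_⊔ y) x≤y ⟨
    x ⊓ y ⊔ y   ≡⟨ ⊔-comm (x ⊓ y) y ⟩
    y ⊔ (x ⊓ y) ≡⟨ cong (y ⊔_) (⊓-comm x y) ⟩
    y ⊔ (y ⊓ x) ≡⟨ ⊔-absorbs-⊓ y x ⟩
    y           ∎

  ⊔-least : ∀ {x y z} → x ≤ z → y ≤ z → x ⊔ y ≤ z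
  ⊔-least {x} {y} {z} x≤z y≤z = begin
    x ⊔ y       ≤⟨ x≤x⊔y ⟩
    x ⊔ y ⊔ z   ≡⟨ ⊔-assoc x y z ⟩
    x ⊔ (y ⊔ z) ≡⟨ cong (x ⊔_) (≤⇒⊔≡ y≤z) ⟩
    x ⊔ z       ≡⟨ ≤⇒⊔≡ x≤z ⟩
    z           ∎

  ∙-commutativeSemigroup : CommutativeSemigroup _ _
  ∙-commutativeSemigroup = record
    { isCommutativeSemigroup = record
      { isSemigroup = record
        { isMagma = record { isEquivalence = isEquivalence ; ∙-cong = cong₂ _∙_ }
        ; assoc = ∙-assoc
        }
      ; comm = ∙-comm
      }
    }

  open import Algebra.Properties.CommutativeSemigroup ∙-commutativeSemigroup public
    using (xy∙z≈xz∙y)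

  ∙-identityʳ : ∀ x → x ∙ 𝟏 ≡ x
  ∙-identityʳ x = trans (∙-comm x 𝟏) (∙-identityˡ x)

  ↝-intro : ∀ {x y z} → x ∙ y ≤ z → x ≤ y ↝ z
  ↝-intro {x} {y} {z} = Equivalence.to (residuated x y z)

  ↝-elim : ∀ {x y z} → x ≤ y ↝ z → x ∙ y ≤ z
  ↝-elim {x} {y} {z} = Equivalence.from (residuated x y z)

  modus-ponens : ∀ {x y} → (x ↝ y) ∙ x ≤ y
  modus-ponens = ↝-elim ≤-refl

  ∙-monoˡ-≤ : ∀ {x x′ y} → x ≤ x′ → x ∙ y ≤ x′ ∙ y
  ∙-monoˡ-≤ x≤x′ = ↝-elim (≤-trans x≤x′ (↝-intro ≤-refl))

  ∙-monoʳ-≤ : ∀ {x y y′} → y ≤ y′ → x ∙ y ≤ x ∙ y′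
  ∙-monoʳ-≤ {x} {y} {y′} y≤y′ = begin
    x ∙ y  ≡⟨ ∙-comm x y ⟩
    y ∙ x  ≤⟨ ∙-monoˡ-≤ y≤y′ ⟩
    y′ ∙ x ≡⟨ ∙-comm y′ x ⟩
    x ∙ y′ ∎

  ∙-mono-≤ : ∀ {x x′ y y′} → x ≤ x′ → y ≤ y′ → x ∙ y ≤ x′ ∙ y′
  ∙-mono-≤ x≤x′ y≤y′ = ≤-trans (∙-monoˡ-≤ x≤x′) (∙-monoʳ-≤ y≤y′)

  ↝-antimonoˡ-≤ : ∀ {x x′ y} → x ≤ x′ → x′ ↝ y ≤ x ↝ y
  ↝-antimonoˡ-≤ x≤x′ = ↝-intro (≤-trans (∙-monoʳ-≤ x≤x′) modus-ponens)

  ≤⇒𝟏≤↝ : ∀ {x y} → x ≤ y → 𝟏 ≤ x ↝ y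
  ≤⇒𝟏≤↝ {x} x≤y = ↝-intro (≤-trans (≤-reflexive (∙-identityˡ x)) x≤y)

  𝟏≤↝⇒≤ : ∀ {x y} → 𝟏 ≤ x ↝ y → x ≤ y
  𝟏≤↝⇒≤ {x} 𝟏≤x↝y = ≤-trans (≤-reflexive (sym (∙-identityˡ x))) (↝-elim 𝟏≤x↝y)

  𝟏≤∙ : ∀ {x y} → 𝟏 ≤ x → 𝟏 ≤ y → 𝟏 ≤ x ∙ y
  𝟏≤∙ 𝟏≤x 𝟏≤y = ≤-trans (≤-reflexive (sym (∙-identityˡ 𝟏))) (∙-mono-≤ 𝟏≤x 𝟏≤y)

  ∼-antimono-≤ : ∀ {x y} → x ≤ y → ∼ y ≤ ∼ x
  ∼-antimono-≤ = ↝-antimonoˡ-≤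

  ∼∼-mono-≤ : ∀ {x y} → x ≤ y → ∼ ∼ x ≤ ∼ ∼ y
  ∼∼-mono-≤ = ∼-antimono-≤ ∘ ∼-antimono-≤

  x∙[x↝y]≤y : ∀ {x y} → x ∙ (x ↝ y) ≤ y
  x∙[x↝y]≤y {x} {y} = ≤-trans (≤-reflexive (∙-comm x (x ↝ y))) modus-ponens

  ≤∼-flip : ∀ {x y} → x ≤ ∼ y → y ≤ ∼ x
  ≤∼-flip {x} {y} x≤∼y = ↝-intro (≤-trans (≤-reflexive (∙-comm y x)) (↝-elim x≤∼y))

  x≤∼∼x : ∀ {x} → x ≤ ∼ ∼ x
  x≤∼∼x = ↝-intro x∙[x↝y]≤y

  ∼∼∼x≡∼x : ∀ {x} → ∼ ∼ ∼ x ≡ ∼ x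
  ∼∼∼x≡∼x = ≤-antisym (∼-antimono-≤ x≤∼∼x) x≤∼∼x

  x≤∼y⇒∼∼x≤∼y : ∀ {x y} → x ≤ ∼ y → ∼ ∼ x ≤ ∼ y
  x≤∼y⇒∼∼x≤∼y x≤∼y = ≤-trans (∼∼-mono-≤ x≤∼y) (≤-reflexive ∼∼∼x≡∼x)

  𝟏≤∼∼∼x⇒𝟏≤∼x : ∀ {x} → 𝟏 ≤ ∼ ∼ ∼ x → 𝟏 ≤ ∼ x
  𝟏≤∼∼∼x⇒𝟏≤∼x 𝟏≤∼∼∼x = ≤-trans 𝟏≤∼∼∼x (≤-reflexive ∼∼∼x≡∼x)

  𝟏≤∼∼∼x⇒x≤𝟎 : ∀ {x} → 𝟏 ≤ ∼ ∼ ∼ x → x ≤ 𝟎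
  𝟏≤∼∼∼x⇒x≤𝟎 = 𝟏≤↝⇒≤ ∘ 𝟏≤∼∼∼x⇒𝟏≤∼x

  x≤𝟎⇒𝟏≤∼x : ∀ {x} → x ≤ 𝟎 → 𝟏 ≤ ∼ x
  x≤𝟎⇒𝟏≤∼x {x} x≤𝟎 = ↝-intro (≤-trans (≤-reflexive (∙-identityˡ x)) x≤𝟎)

  ∼𝟏≤𝟎 : ∼ 𝟏 ≤ 𝟎
  ∼𝟏≤𝟎 = ≤-trans (≤-reflexive (sym (∙-identityʳ (∼ 𝟏)))) modus-ponens

  ∼∼𝟎≤𝟎 : ∼ ∼ 𝟎 ≤ 𝟎
  ∼∼𝟎≤𝟎 = ≤-trans (∼-antimono-≤ (≤⇒𝟏≤↝ ≤-refl)) ∼𝟏≤𝟎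

  x≤∼∼𝟏⇒x∙𝟎≤𝟎 : (∀ x → x ≤ ∼ ∼ 𝟏) → ∀ x → x ∙ 𝟎 ≤ 𝟎
  x≤∼∼𝟏⇒x∙𝟎≤𝟎 x≤∼∼𝟏 x = begin
    x ∙ 𝟎         ≤⟨ ∙-mono-≤ (x≤∼∼𝟏 x) 𝟎≤∼𝟏 ⟩
    ∼ ∼ 𝟏 ∙ ∼ 𝟏   ≤⟨ modus-ponens ⟩
    𝟎             ∎
    where
    𝟎≤∼𝟏 : 𝟎 ≤ ∼ 𝟏
    𝟎≤∼𝟏 = ↝-intro (≤-reflexive (∙-identityʳ 𝟎))

  ↝∼-curry : ∀ {x y} → x ↝ ∼ y ≤ ∼ (x ∙ y)
  ↝∼-curry {x} {y} = ↝-intro (≤-trans (≤-reflexive (sym (∙-assoc (x ↝ ∼ y) x y))) (↝-elim modus-ponens))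

  ∼-uncurry : ∀ {x y} → ∼ (x ∙ y) ≤ x ↝ ∼ y
  ∼-uncurry {x} {y} = ↝-intro (↝-intro (≤-trans (≤-reflexive (∙-assoc (∼ (x ∙ y)) x y)) modus-ponens))

  x∙y≤∼[x↝∼y] : ∀ {x y} → x ∙ y ≤ ∼ (x ↝ ∼ y)
  x∙y≤∼[x↝∼y] {x} {y} = ↝-intro (begin
    x ∙ y ∙ (x ↝ ∼ y)   ≡⟨ ∙-comm (x ∙ y) (x ↝ ∼ y) ⟩
    (x ↝ ∼ y) ∙ (x ∙ y) ≤⟨ ↝-elim ↝∼-curry ⟩
    𝟎                   ∎)

  ∼∼x∙∼∼y≤∼∼[x∙y] : ∀ {x y} → ∼ ∼ x ∙ ∼ ∼ y ≤ ∼ ∼ (x ∙ y)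
  ∼∼x∙∼∼y≤∼∼[x∙y] {x} {y} = ↝-intro (begin
    ∼ ∼ x ∙ ∼ ∼ y ∙ ∼ (x ∙ y)   ≡⟨ ∙-assoc (∼ ∼ x) (∼ ∼ y) (∼ (x ∙ y)) ⟩
    ∼ ∼ x ∙ (∼ ∼ y ∙ ∼ (x ∙ y)) ≤⟨ ∙-monoʳ-≤ (↝-elim ∼∼y≤∼[x∙y]↝∼x) ⟩
    ∼ ∼ x ∙ ∼ x                 ≤⟨ modus-ponens ⟩
    𝟎                           ∎)
    where
    ∼∼y≤∼[x∙y]↝∼x : ∼ ∼ y ≤ ∼ (x ∙ y) ↝ ∼ x
    ∼∼y≤∼[x∙y]↝∼x = ≤-trans (∼-antimono-≤ (↝-elim ∼-uncurry)) ∼-uncurry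

  ∼x⊓∼y≤∼[x⊔y] : ∀ {x y} → ∼ x ⊓ ∼ y ≤ ∼ (x ⊔ y)
  ∼x⊓∼y≤∼[x⊔y] = ≤∼-flip (⊔-least
    (≤-trans x≤∼∼x (∼-antimono-≤ x⊓y≤x))
    (≤-trans x≤∼∼x (∼-antimono-≤ x⊓y≤y)))

  ∼∼x∙[x↝y]≤∼∼y : ∀ {x y} → ∼ ∼ x ∙ (x ↝ y) ≤ ∼ ∼ y
  ∼∼x∙[x↝y]≤∼∼y {x} {y} = begin
    ∼ ∼ x ∙ (x ↝ y)       ≤⟨ ∙-monoʳ-≤ x≤∼∼x ⟩
    ∼ ∼ x ∙ ∼ ∼ (x ↝ y)   ≤⟨ ∼∼x∙∼∼y≤∼∼[x∙y] ⟩
    ∼ ∼ (x ∙ (x ↝ y))     ≤⟨ ∼∼-mono-≤ x∙[x↝y]≤y ⟩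
    ∼ ∼ y                 ∎

  ∼∼x↝∼∼y≤∼∼[x↝y] : ∀ {x y} → 𝟏 ≤ ∼ ∼ (∼ ∼ y ↝ y) → ∼ ∼ x ↝ ∼ ∼ y ≤ ∼ ∼ (x ↝ y)
  ∼∼x↝∼∼y≤∼∼[x↝y] {x} {y} 𝟏≤∼∼[∼∼y↝y] = begin
    k                             ≡⟨ ∙-identityʳ k ⟨
    k ∙ 𝟏                         ≤⟨ ∙-mono-≤ x≤∼∼x 𝟏≤∼∼[∼∼y↝y] ⟩
    ∼ ∼ k ∙ ∼ ∼ (∼ ∼ y ↝ y)       ≤⟨ ∼∼x∙∼∼y≤∼∼[x∙y] ⟩
    ∼ ∼ (k ∙ (∼ ∼ y ↝ y))         ≤⟨ ∼∼-mono-≤ (↝-intro k∙[∼∼y↝y]∙x≤y) ⟩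
    ∼ ∼ (x ↝ y)                   ∎
    where
    k = ∼ ∼ x ↝ ∼ ∼ y
    k∙[∼∼y↝y]∙x≤y : k ∙ (∼ ∼ y ↝ y) ∙ x ≤ y
    k∙[∼∼y↝y]∙x≤y = begin
      k ∙ (∼ ∼ y ↝ y) ∙ x   ≡⟨ xy∙z≈xz∙y k (∼ ∼ y ↝ y) x ⟩
      k ∙ x ∙ (∼ ∼ y ↝ y)   ≤⟨ ∙-monoˡ-≤ (↝-elim (↝-antimonoˡ-≤ x≤∼∼x)) ⟩
      ∼ ∼ y ∙ (∼ ∼ y ↝ y)   ≤⟨ x∙[x↝y]≤y ⟩
      y                     ∎

  module ZeroAbsorbing (x∙𝟎≤𝟎 : ∀ x → x ∙ 𝟎 ≤ 𝟎) where

    𝟎∙x≤𝟎 : ∀ {x} → 𝟎 ∙ x ≤ 𝟎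
    𝟎∙x≤𝟎 {x} = ≤-trans (≤-reflexive (∙-comm 𝟎 x)) (x∙𝟎≤𝟎 x)

    𝟎≤∼x : ∀ {x} → 𝟎 ≤ ∼ x
    𝟎≤∼x = ↝-intro 𝟎∙x≤𝟎

    x≤∼𝟎 : ∀ {x} → x ≤ ∼ 𝟎
    x≤∼𝟎 {x} = ↝-intro (x∙𝟎≤𝟎 x)

    x≤∼∼𝟏 : ∀ {x} → x ≤ ∼ ∼ 𝟏
    x≤∼∼𝟏 = ≤-trans x≤∼𝟎 (∼-antimono-≤ ∼𝟏≤𝟎)

    ∼x∙y≤∼x : ∀ {x y} → ∼ x ∙ y ≤ ∼ x
    ∼x∙y≤∼x {x} {y} = ↝-intro (begin
      ∼ x ∙ y ∙ x   ≡⟨ xy∙z≈xz∙y (∼ x) y x ⟩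
      ∼ x ∙ x ∙ y   ≤⟨ ∙-monoˡ-≤ modus-ponens ⟩
      𝟎 ∙ y         ≤⟨ 𝟎∙x≤𝟎 ⟩
      𝟎             ∎)

    [x↝∼y]∙z≤x↝∼y : ∀ {x y z} → (x ↝ ∼ y) ∙ z ≤ x ↝ ∼ y
    [x↝∼y]∙z≤x↝∼y {x} {y} {z} = ↝-intro (begin
      (x ↝ ∼ y) ∙ z ∙ x   ≡⟨ xy∙z≈xz∙y (x ↝ ∼ y) z x ⟩
      (x ↝ ∼ y) ∙ x ∙ z   ≤⟨ ∙-monoˡ-≤ modus-ponens ⟩
      ∼ y ∙ z             ≤⟨ ∼x∙y≤∼x ⟩
      ∼ y                 ∎)

    ∼x≤∼[x∙y] : ∀ {x y} → ∼ x ≤ ∼ (x ∙ y)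
    ∼x≤∼[x∙y] {x} {y} = ↝-intro (begin
      ∼ x ∙ (x ∙ y)   ≡⟨ ∙-assoc (∼ x) x y ⟨
      ∼ x ∙ x ∙ y     ≤⟨ ∙-monoˡ-≤ modus-ponens ⟩
      𝟎 ∙ y           ≤⟨ 𝟎∙x≤𝟎 ⟩
      𝟎               ∎)

    ∼y≤∼[x∙y] : ∀ {x y} → ∼ y ≤ ∼ (x ∙ y)
    ∼y≤∼[x∙y] {x} {y} = ≤-trans ∼x≤∼[x∙y] (≤-reflexive (cong ∼_ (∙-comm y x)))

    x∙[∼∼𝟏↝𝟏]≤𝟏 : ∀ {x} → x ∙ (∼ ∼ 𝟏 ↝ 𝟏) ≤ 𝟏
    x∙[∼∼𝟏↝𝟏]≤𝟏 = ≤-trans (∙-monoˡ-≤ x≤∼∼𝟏) x∙[x↝y]≤y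

  module Contraction (x≤∼∼[x∙x] : ∀ x → x ≤ ∼ ∼ (x ∙ x)) where

    ∼[x∙x]≤∼x : ∀ {x} → ∼ (x ∙ x) ≤ ∼ x
    ∼[x∙x]≤∼x {x} = ≤-trans (≤-reflexive (sym ∼∼∼x≡∼x)) (∼-antimono-≤ (x≤∼∼[x∙x] x))

    x⊓y≤∼∼[x∙y] : ∀ {x y} → x ⊓ y ≤ ∼ ∼ (x ∙ y)
    x⊓y≤∼∼[x∙y] = ≤-trans (x≤∼∼[x∙x] _) (∼∼-mono-≤ (∙-mono-≤ x⊓y≤x x⊓y≤y))

    ∼x⊓∼∼x≤𝟎 : ∀ {x} → ∼ x ⊓ ∼ ∼ x ≤ 𝟎
    ∼x⊓∼∼x≤𝟎 = ≤-trans x⊓y≤∼∼[x∙y] (≤-trans (∼∼-mono-≤ x∙[x↝y]≤y) ∼∼𝟎≤𝟎)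

    ∼∼x⊓∼∼y≤∼∼[x∙y] : ∀ {x y} → ∼ ∼ x ⊓ ∼ ∼ y ≤ ∼ ∼ (x ∙ y)
    ∼∼x⊓∼∼y≤∼∼[x∙y] = ≤-trans x⊓y≤∼∼[x∙y] (x≤∼y⇒∼∼x≤∼y ∼∼x∙∼∼y≤∼∼[x∙y])

    ∼∼x⊓∼y≤∼[x↝y] : ∀ {x y} → ∼ ∼ x ⊓ ∼ y ≤ ∼ (x ↝ y)
    ∼∼x⊓∼y≤∼[x↝y] {x} {y} = ≤-trans x⊓y≤∼∼[x∙y] (x≤∼y⇒∼∼x≤∼y (↝-intro (begin
      ∼ ∼ x ∙ ∼ y ∙ (x ↝ y)   ≡⟨ xy∙z≈xz∙y (∼ ∼ x) (∼ y) (x ↝ y) ⟩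
      ∼ ∼ x ∙ (x ↝ y) ∙ ∼ y   ≤⟨ ∙-monoˡ-≤ ∼∼x∙[x↝y]≤∼∼y ⟩
      ∼ ∼ y ∙ ∼ y             ≤⟨ modus-ponens ⟩
      𝟎                       ∎)))

    x≤x′⇒x′↝∼x≤∼x : ∀ {x x′} → x ≤ x′ → x′ ↝ ∼ x ≤ ∼ x
    x≤x′⇒x′↝∼x≤∼x x≤x′ = ≤-trans ↝∼-curry (≤-trans (∼-antimono-≤ (∙-monoˡ-≤ x≤x′)) ∼[x∙x]≤∼x)

    ∼∼x↝∼x≤∼x : ∀ {x} → ∼ ∼ x ↝ ∼ x ≤ ∼ x
    ∼∼x↝∼x≤∼x = x≤x′⇒x′↝∼x≤∼x x≤∼∼x

    ∼x↝∼∼∼∼x≤∼∼x : ∀ {x} → ∼ x ↝ ∼ ∼ ∼ ∼ x ≤ ∼ ∼ x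
    ∼x↝∼∼∼∼x≤∼∼x = ≤-trans (x≤x′⇒x′↝∼x≤∼x (≤-reflexive ∼∼∼x≡∼x)) (≤-reflexive (cong ∼_ ∼∼∼x≡∼x))

    op[∼∼x,∼x]≤𝟎 : ∀ c {x} → op c A (∼ ∼ x) (∼ x) ≤ 𝟎
    op[∼∼x,∼x]≤𝟎 wedge = ≤-trans
      (⊓-greatest (≤-trans x⊓y≤x ∼∼x↝∼x≤∼x) (≤-trans x⊓y≤y ∼x↝∼∼∼∼x≤∼∼x)) ∼x⊓∼∼x≤𝟎
    op[∼∼x,∼x]≤𝟎 circ  = ≤-trans (∙-mono-≤ ∼∼x↝∼x≤∼x ∼x↝∼∼∼∼x≤∼∼x) x∙[x↝y]≤y

    ∼-by-cases : ∀ {c x y} → c ∙ ∼ ∼ x ≤ ∼ y → c ∙ ∼ x ≤ ∼ y → c ≤ ∼ y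
    ∼-by-cases {c} {x} {y} c∙∼∼x≤∼y c∙∼x≤∼y = ↝-intro (≤-trans
      (⊓-greatest (≤-trans (swap c∙∼∼x≤∼y) (≤-reflexive ∼∼∼x≡∼x)) (swap c∙∼x≤∼y))
      ∼x⊓∼∼x≤𝟎)
      where
      swap : ∀ {z} → c ∙ z ≤ ∼ y → c ∙ y ≤ ∼ z
      swap {z} c∙z≤∼y = ↝-intro (≤-trans (≤-reflexive (xy∙z≈xz∙y c y z)) (↝-elim c∙z≤∼y))

  record IsGlivenkoAlgebra : Set where
    field
      x∙𝟎≤𝟎       : ∀ x → x ∙ 𝟎 ≤ 𝟎
      x≤∼∼[x∙x]   : ∀ x → x ≤ ∼ ∼ (x ∙ x)
      𝟏≤∼∼[∼∼x↝x] : ∀ x → 𝟏 ≤ ∼ ∼ (∼ ∼ x ↝ x)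

  signed : Bool → Carrier A → Carrier A
  signed true  x = ∼ ∼ x
  signed false x = ∼ x

  module Kalmar (isGlivenkoAlgebra : IsGlivenkoAlgebra) where
    open IsGlivenkoAlgebra isGlivenkoAlgebra
    open ZeroAbsorbing x∙𝟎≤𝟎
    open Contraction x≤∼∼[x∙x]

    ∼∼x⊓∼∼y≤∼∼[x⊓y] : ∀ {x y} → ∼ ∼ x ⊓ ∼ ∼ y ≤ ∼ ∼ (x ⊓ y)
    ∼∼x⊓∼∼y≤∼∼[x⊓y] {x} {y} = begin
      ∼ ∼ x ⊓ ∼ ∼ y         ≤⟨ ∼∼x⊓∼∼y≤∼∼[x∙y] ⟩
      ∼ ∼ (x ∙ y)           ≡⟨ ∙-identityʳ _ ⟨
      ∼ ∼ (x ∙ y) ∙ 𝟏       ≤⟨ ∙-monoʳ-≤ (𝟏≤∼∼[∼∼x↝x] 𝟏) ⟩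
      ∼ ∼ (x ∙ y) ∙ ∼ ∼ t   ≤⟨ ∼∼x∙∼∼y≤∼∼[x∙y] ⟩
      ∼ ∼ (x ∙ y ∙ t)       ≤⟨ ∼∼-mono-≤ (⊓-greatest x∙y∙t≤x x∙y∙t≤y) ⟩
      ∼ ∼ (x ⊓ y)           ∎
      where
      t = ∼ ∼ 𝟏 ↝ 𝟏
      x∙y∙t≤x : x ∙ y ∙ t ≤ x
      x∙y∙t≤x = begin
        x ∙ y ∙ t     ≡⟨ ∙-assoc x y t ⟩
        x ∙ (y ∙ t)   ≤⟨ ∙-monoʳ-≤ x∙[∼∼𝟏↝𝟏]≤𝟏 ⟩
        x ∙ 𝟏         ≡⟨ ∙-identityʳ x ⟩
        x             ∎
      x∙y∙t≤y : x ∙ y ∙ t ≤ y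
      x∙y∙t≤y = begin
        x ∙ y ∙ t     ≡⟨ xy∙z≈xz∙y x y t ⟩
        x ∙ t ∙ y     ≤⟨ ∙-monoˡ-≤ x∙[∼∼𝟏↝𝟏]≤𝟏 ⟩
        𝟏 ∙ y         ≡⟨ ∙-identityˡ y ⟩
        y             ∎

    ∼x≤∼∼[x↝y] : ∀ {x y} → ∼ x ≤ ∼ ∼ (x ↝ y)
    ∼x≤∼∼[x↝y] {x} {y} =
      ≤-trans (↝-intro (≤-trans x∙[x↝y]≤y 𝟎≤∼x)) (∼∼x↝∼∼y≤∼∼[x↝y] (𝟏≤∼∼[∼∼x↝x] y))

    ∼∼y≤∼∼[x↝y] : ∀ {x y} → ∼ ∼ y ≤ ∼ ∼ (x ↝ y)
    ∼∼y≤∼∼[x↝y] {x} {y} = ≤-trans (↝-intro ∼x∙y≤∼x) (∼∼x↝∼∼y≤∼∼[x↝y] (𝟏≤∼∼[∼∼x↝x] y))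

    signed-absorbs : ∀ s {x y} → signed s x ∙ y ≤ signed s x
    signed-absorbs true  = ∼x∙y≤∼x
    signed-absorbs false = ∼x∙y≤∼x

    signed-⊓ : ∀ s t x y → signed s x ⊓ signed t y ≤ signed (s ∧ t) (x ⊓ y)
    signed-⊓ true  true  _ _ = ∼∼x⊓∼∼y≤∼∼[x⊓y]
    signed-⊓ true  false _ _ = ≤-trans x⊓y≤y (∼-antimono-≤ x⊓y≤y)
    signed-⊓ false _     _ _ = ≤-trans x⊓y≤x (∼-antimono-≤ x⊓y≤x)

    signed-⊔ : ∀ s t x y → signed s x ⊓ signed t y ≤ signed (s ∨ t) (x ⊔ y)
    signed-⊔ true  _     _ _ = ≤-trans x⊓y≤x (∼∼-mono-≤ x≤x⊔y)
    signed-⊔ false true  _ _ = ≤-trans x⊓y≤y (∼∼-mono-≤ y≤x⊔y)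
    signed-⊔ false false _ _ = ∼x⊓∼y≤∼[x⊔y]

    signed-∙ : ∀ s t x y → signed s x ⊓ signed t y ≤ signed (s ∧ t) (x ∙ y)
    signed-∙ true  true  _ _ = ∼∼x⊓∼∼y≤∼∼[x∙y]
    signed-∙ true  false _ _ = ≤-trans x⊓y≤y ∼y≤∼[x∙y]
    signed-∙ false _     _ _ = ≤-trans x⊓y≤x ∼x≤∼[x∙y]

    signed-↝ : ∀ s t x y → signed s x ⊓ signed t y ≤ signed (s →ᵇ t) (x ↝ y)
    signed-↝ true  true  _ _ = ≤-trans x⊓y≤y ∼∼y≤∼∼[x↝y]
    signed-↝ true  false _ _ = ∼∼x⊓∼y≤∼[x↝y]
    signed-↝ false _     _ _ = ≤-trans x⊓y≤x ∼x≤∼∼[x↝y]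

    kalmar : ∀ ψ b v {c} → (∀ {n} → n ∈ vars ψ → c ≤ signed (b n) (v n)) →
             c ≤ signed (⟦ ψ ⟧ B₂ b) (⟦ ψ ⟧ A v)
    kalmar₂ : ∀ (_⊕_ : Bool → Bool → Bool) (_⊛_ : Carrier A → Carrier A → Carrier A) →
              (∀ s t x y → signed s x ⊓ signed t y ≤ signed (s ⊕ t) (x ⊛ y)) →
              ∀ φ ψ b v {c} → (∀ {n} → n ∈ vars φ ++ vars ψ → c ≤ signed (b n) (v n)) →
              c ≤ signed (⟦ φ ⟧ B₂ b ⊕ ⟦ ψ ⟧ B₂ b) (⟦ φ ⟧ A v ⊛ ⟦ ψ ⟧ A v)

    kalmar (var n)  b v h = h (here refl)
    kalmar (φ ∧ᶠ ψ) b v h = kalmar₂ _∧_ _⊓_ signed-⊓ φ ψ b v h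
    kalmar (φ ∨ᶠ ψ) b v h = kalmar₂ _∨_ _⊔_ signed-⊔ φ ψ b v h
    kalmar (φ ·ᶠ ψ) b v h = kalmar₂ _∧_ _∙_ signed-∙ φ ψ b v h
    kalmar (φ ⟶ᶠ ψ) b v h = kalmar₂ _→ᵇ_ _↝_ signed-↝ φ ψ b v h
    kalmar 𝟘ᶠ       b v _ = x≤∼𝟎
    kalmar 𝟙ᶠ       b v _ = x≤∼∼𝟏

    kalmar₂ _ _ signed-⊛ φ ψ b v h = ≤-trans
      (⊓-greatest (kalmar φ b v (h ∘ ∈-++⁺ˡ)) (kalmar ψ b v (h ∘ ∈-++⁺ʳ (vars φ))))
      (signed-⊛ (⟦ φ ⟧ B₂ b) (⟦ ψ ⟧ B₂ b) (⟦ φ ⟧ A v) (⟦ ψ ⟧ A v))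

    eliminate : ∀ ψ → Tautology ψ → ∀ v ns {b c} →
                (∀ {n} → n ∈ vars ψ → n ∉ ns → c ≤ signed (b n) (v n)) → c ≤ ∼ ∼ (⟦ ψ ⟧ A v)
    eliminate ψ taut v [] {b} {c} h =
      subst (λ s → c ≤ signed s (⟦ ψ ⟧ A v)) (taut b) (kalmar ψ b v (λ n∈ψ → h n∈ψ λ ()))
    eliminate ψ taut v (n ∷ ns) {b} {c} h =
      ∼-by-cases (eliminate ψ taut v ns {update b n true} (fix true))
                 (eliminate ψ taut v ns {update b n false} (fix false))
      where
      fix : ∀ s {m} → m ∈ vars ψ → m ∉ ns → c ∙ signed s (v n) ≤ signed (update b n s m) (v m)
      fix s {m} m∈ψ m∉ns with m ≟ n
      ... | yes refl = ≤-trans (≤-reflexive (∙-comm c _)) (signed-absorbs s)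
      ... | no  m≢n  = ≤-trans
        (∙-monoˡ-≤ (h m∈ψ λ { (here m≡n) → m≢n m≡n ; (there m∈ns) → m∉ns m∈ns }))
        (signed-absorbs (b m))

    satisfiesGlivenko : SatisfiesGlivenko A
    satisfiesGlivenko ψ taut v =
      eliminate ψ taut v (vars ψ) {λ _ → true} {𝟏} (λ n∈ψ n∉ψ → ⊥-elim (n∉ψ n∈ψ))

  module Boolean (isBoolean : IsBoolean A) where

    private
      x∙y≡x⊓y : ∀ x y → x ∙ y ≡ x ⊓ y
      x∙y≡x⊓y = proj₁ (proj₁ isBoolean)
      𝟎≤x : ∀ x → 𝟎 ≤ x
      𝟎≤x = proj₂ (proj₁ isBoolean)
      x⊔∼x≡𝟏 : ∀ x → x ⊔ ∼ x ≡ 𝟏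
      x⊔∼x≡𝟏 = proj₂ isBoolean

    ∼∼x≤x : ∀ {x} → ∼ ∼ x ≤ x
    ∼∼x≤x {x} = begin
      ∼ ∼ x               ≡⟨ ∙-identityˡ (∼ ∼ x) ⟨
      𝟏 ∙ ∼ ∼ x           ≡⟨ cong (_∙ ∼ ∼ x) (x⊔∼x≡𝟏 x) ⟨
      (x ⊔ ∼ x) ∙ ∼ ∼ x   ≤⟨ ↝-elim (⊔-least x≤∼∼x↝x ∼x≤∼∼x↝x) ⟩
      x                   ∎
      where
      x≤∼∼x↝x : x ≤ ∼ ∼ x ↝ x
      x≤∼∼x↝x = ↝-intro (≤-trans (≤-reflexive (x∙y≡x⊓y x (∼ ∼ x))) x⊓y≤x)
      ∼x≤∼∼x↝x : ∼ x ≤ ∼ ∼ x ↝ x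
      ∼x≤∼∼x↝x = ↝-intro (≤-trans x∙[x↝y]≤y (𝟎≤x x))

    isGlivenkoAlgebra : IsGlivenkoAlgebra
    isGlivenkoAlgebra = record
      { x∙𝟎≤𝟎 = λ x → ≤-trans (≤-reflexive (x∙y≡x⊓y x 𝟎)) x⊓y≤y
      ; x≤∼∼[x∙x] = λ x → ≤-trans (≤-reflexive (trans (sym (⊓-idem x)) (sym (x∙y≡x⊓y x x)))) x≤∼∼x
      ; 𝟏≤∼∼[∼∼x↝x] = λ x → ≤-trans (≤⇒𝟏≤↝ ∼∼x≤x) x≤∼∼x
      }

    tautology⇒valid : ∀ ψ → Tautology ψ → Valid A ψ
    tautology⇒valid ψ taut v = ≤-trans (Kalmar.satisfiesGlivenko isGlivenkoAlgebra ψ taut v) ∼∼x≤x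

-- Boethius' theses and contradictories

p q : Formula
p = var 0
q = var 1

assign : ∀ {X : Set} → X → X → ℕ → X
assign x y 0       = x
assign x y (suc _) = y

¬[p⇒¬p]-tautology : ∀ c → Tautology (¬ᶠ (p ⇒[ c ] ¬ᶠ p))
¬[p⇒¬p]-tautology wedge b with b 0
... | false = refl
... | true  = refl
¬[p⇒¬p]-tautology circ b with b 0
... | false = refl
... | true  = refl

¬[¬p⇒p]-tautology : ∀ c → Tautology (¬ᶠ (¬ᶠ p ⇒[ c ] p))
¬[¬p⇒p]-tautology wedge b with b 0
... | false = refl
... | true  = refl
¬[¬p⇒p]-tautology circ b with b 0
... | false = refl
... | true  = refl

contrary-tautology : ∀ c → Tautology (¬ᶠ ((p ⇒[ c ] q) ·ᶠ (p ⇒[ c ] ¬ᶠ q)))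
contrary-tautology wedge b with b 0 | b 1
... | false | false = refl
... | false | true  = refl
... | true  | false = refl
... | true  | true  = refl
contrary-tautology circ b with b 0 | b 1
... | false | false = refl
... | false | true  = refl
... | true  | false = refl
... | true  | true  = refl

subcontrary-tautology : ∀ c → Tautology (¬ᶠ (¬ᶠ (p ⇒[ c ] ¬ᶠ q) ·ᶠ ¬ᶠ (p ⇒[ c ] q)))
subcontrary-tautology wedge b with b 0 | b 1
... | false | false = refl
... | false | true  = refl
... | true  | false = refl
... | true  | true  = refl
subcontrary-tautology circ b with b 0 | b 1
... | false | false = refl
... | false | true  = refl
... | true  | false = refl
... | true  | true  = refl

module ConnexiveAlgebra (A : FLe) where

  open FLeProperties A

  ⟦⇒⟧ : ∀ c φ ψ v → ⟦ φ ⇒[ c ] ψ ⟧ A v ≡ op c A (⟦ φ ⟧ A v) (⟦ ψ ⟧ A v)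
  ⟦⇒⟧ wedge _ _ _ = refl
  ⟦⇒⟧ circ  _ _ _ = refl

  ⟦boethius⟧ : ∀ c φ ψ χ v → ⟦ (φ ⇒[ c ] ψ) ⇒[ c ] ¬ᶠ (φ ⇒[ c ] χ) ⟧ A v ≡
               op c A (op c A (⟦ φ ⟧ A v) (⟦ ψ ⟧ A v)) (∼ op c A (⟦ φ ⟧ A v) (⟦ χ ⟧ A v))
  ⟦boethius⟧ wedge _ _ _ _ = refl
  ⟦boethius⟧ circ  _ _ _ _ = refl

  op-intro : ∀ c {x y} → 𝟏 ≤ x ↝ y → 𝟏 ≤ y ↝ ∼ ∼ x → 𝟏 ≤ op c A x y
  op-intro wedge = ⊓-greatest
  op-intro circ  = 𝟏≤∙

  𝟏≤op-refl : ∀ c {x} → 𝟏 ≤ op c A x x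
  𝟏≤op-refl c = op-intro c (≤⇒𝟏≤↝ ≤-refl) (≤⇒𝟏≤↝ x≤∼∼x)

  Contradictory : Carrier A → Carrier A → Set
  Contradictory a b = (a ∙ b ≤ 𝟎) × (∼ b ∙ ∼ a ≤ 𝟎)

  contradictory-sym : ∀ {a b} → Contradictory a b → Contradictory b a
  contradictory-sym {a} {b} (a∙b≤𝟎 , ∼b∙∼a≤𝟎) =
    ≤-trans (≤-reflexive (∙-comm b a)) a∙b≤𝟎 , ≤-trans (≤-reflexive (∙-comm (∼ a) (∼ b))) ∼b∙∼a≤𝟎

  contradictory⇒𝟏≤op : ∀ c {a b} → Contradictory a b → 𝟏 ≤ op c A a (∼ b)
  contradictory⇒𝟏≤op c (a∙b≤𝟎 , ∼b∙∼a≤𝟎) = op-intro c (≤⇒𝟏≤↝ (↝-intro a∙b≤𝟎)) (≤⇒𝟏≤↝ (↝-intro ∼b∙∼a≤𝟎))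

  𝟏≤op∧⇒contradictory : ∀ {a b} → 𝟏 ≤ op wedge A a (∼ b) → Contradictory a b
  𝟏≤op∧⇒contradictory 𝟏≤op = ↝-elim (𝟏≤↝⇒≤ (≤-trans 𝟏≤op x⊓y≤x)) , ↝-elim (𝟏≤↝⇒≤ (≤-trans 𝟏≤op x⊓y≤y))

  OpsContradictory : Conn → Set
  OpsContradictory c = ∀ x y → Contradictory (op c A x y) (op c A x (∼ y))

  BoethiusAlg : Conn → Set
  BoethiusAlg c = (∀ x y → 𝟏 ≤ op c A (op c A x y) (∼ op c A x (∼ y)))
                ⊎ (∀ x y → 𝟏 ≤ op c A (op c A x (∼ y)) (∼ op c A x y))

  boethiusAlg⇒opsContradictory : ∀ c → (∀ {a b} → 𝟏 ≤ op c A a (∼ b) → Contradictory a b) →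
                                 BoethiusAlg c → OpsContradictory c
  boethiusAlg⇒opsContradictory c elim (inj₁ thesis) x y = elim (thesis x y)
  boethiusAlg⇒opsContradictory c elim (inj₂ thesis) x y = contradictory-sym (elim (thesis x y))

  opsContradictory∧⇒x∙𝟎≤𝟎 : OpsContradictory wedge → ∀ x → x ∙ 𝟎 ≤ 𝟎
  opsContradictory∧⇒x∙𝟎≤𝟎 contradictory w = begin
    w ∙ 𝟎                                       ≤⟨ ∙-monoˡ-≤ w≤x∙x ⟩
    x ∙ x ∙ 𝟎                                   ≡⟨ xy∙z≈xz∙y x x 𝟎 ⟩
    x ∙ 𝟎 ∙ x                                   ≤⟨ ∙-mono-≤ x∙y≤∼[x↝∼y] x≤∼∼x ⟩
    ∼ (x ↝ ∼ 𝟎) ∙ ∼ (x ↝ 𝟎)                     ≤⟨ ∙-mono-≤ (∼-antimono-≤ x⊓y≤x) (∼-antimono-≤ x⊓y≤x) ⟩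
    ∼ op wedge A x (∼ 𝟎) ∙ ∼ op wedge A x 𝟎     ≤⟨ proj₂ (contradictory x 𝟎) ⟩
    𝟎                                           ∎
    where
    x = 𝟏 ⊔ w
    w≤x∙x : w ≤ x ∙ x
    w≤x∙x = ≤-trans (≤-reflexive (sym (∙-identityˡ w))) (∙-mono-≤ x≤x⊔y y≤x⊔y)

  module _ (x∙𝟎≤𝟎 : ∀ x → x ∙ 𝟎 ≤ 𝟎) where
    open ZeroAbsorbing x∙𝟎≤𝟎

    op∘≤op∧ : ∀ {x y} → op circ A x (∼ y) ≤ op wedge A x (∼ y)
    op∘≤op∧ = ⊓-greatest [x↝∼y]∙z≤x↝∼y (≤-trans (≤-reflexive (∙-comm _ _)) [x↝∼y]∙z≤x↝∼y)

    𝟏≤op⇒contradictory : ∀ c {a b} → 𝟏 ≤ op c A a (∼ b) → Contradictory a b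
    𝟏≤op⇒contradictory wedge = 𝟏≤op∧⇒contradictory
    𝟏≤op⇒contradictory circ 𝟏≤op = 𝟏≤op∧⇒contradictory (≤-trans 𝟏≤op op∘≤op∧)

    [x↝∼x]∙x≤op : ∀ c {x} → (x ↝ ∼ x) ∙ x ≤ op c A x (∼ x)
    [x↝∼x]∙x≤op circ  = ∙-monoʳ-≤ (↝-intro (≤-trans x∙[x↝y]≤y 𝟎≤∼x))
    [x↝∼x]∙x≤op wedge = ≤-trans ([x↝∼x]∙x≤op circ) op∘≤op∧

    ∼[x↝y]≤∼op : ∀ c {x y} → ∼ (x ↝ y) ≤ ∼ op c A x y
    ∼[x↝y]≤∼op wedge = ∼-antimono-≤ x⊓y≤x
    ∼[x↝y]≤∼op circ  = ∼x≤∼[x∙y]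

    opsContradictory⇒x≤∼∼[x∙x] : ∀ c → OpsContradictory c → ∀ x → x ≤ ∼ ∼ (x ∙ x)
    opsContradictory⇒x≤∼∼[x∙x] c contradictory x =
      ≤-trans (≤∼-flip (↝-intro [x↝∼x]∙x≤𝟎)) (∼-antimono-≤ ∼-uncurry)
      where
      [x↝∼x]∙x≤𝟎 : (x ↝ ∼ x) ∙ x ≤ 𝟎
      [x↝∼x]∙x≤𝟎 = begin
        (x ↝ ∼ x) ∙ x                      ≤⟨ [x↝∼x]∙x≤op c ⟩
        op c A x (∼ x)                     ≡⟨ ∙-identityˡ _ ⟨
        𝟏 ∙ op c A x (∼ x)                 ≤⟨ ∙-monoˡ-≤ (𝟏≤op-refl c) ⟩
        op c A x x ∙ op c A x (∼ x)        ≤⟨ proj₁ (contradictory x x) ⟩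
        𝟎                                  ∎

    opsContradictory⇒𝟏≤∼∼[∼∼x↝x] : ∀ c → OpsContradictory c → ∀ x → 𝟏 ≤ ∼ ∼ (∼ ∼ x ↝ x)
    opsContradictory⇒𝟏≤∼∼[∼∼x↝x] c contradictory x = ↝-intro (begin
      𝟏 ∙ ∼ (∼ ∼ x ↝ x)                          ≤⟨ ∙-mono-≤ 𝟏≤∼op[∼∼x,∼x] (∼[x↝y]≤∼op c) ⟩
      ∼ op c A (∼ ∼ x) (∼ x) ∙ ∼ op c A (∼ ∼ x) x ≤⟨ proj₂ (contradictory (∼ ∼ x) x) ⟩
      𝟎                                          ∎)
      where
      open Contraction (opsContradictory⇒x≤∼∼[x∙x] c contradictory)
      𝟏≤∼op[∼∼x,∼x] : 𝟏 ≤ ∼ op c A (∼ ∼ x) (∼ x)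
      𝟏≤∼op[∼∼x,∼x] = x≤𝟎⇒𝟏≤∼x (op[∼∼x,∼x]≤𝟎 c)

    opsContradictory⇒isGlivenkoAlgebra : ∀ c → OpsContradictory c → IsGlivenkoAlgebra
    opsContradictory⇒isGlivenkoAlgebra c contradictory = record
      { x∙𝟎≤𝟎 = x∙𝟎≤𝟎
      ; x≤∼∼[x∙x] = opsContradictory⇒x≤∼∼[x∙x] c contradictory
      ; 𝟏≤∼∼[∼∼x↝x] = opsContradictory⇒𝟏≤∼∼[∼∼x↝x] c contradictory
      }

  satisfiesGlivenko⇒protoConnAlg : SatisfiesGlivenko A → ∀ c → ProtoConnAlg A (op c A)
  satisfiesGlivenko⇒protoConnAlg glivenko c =
      𝟏≤∼op[x,∼x] , 𝟏≤∼op[∼x,x]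
    , (λ x y → contradictory⇒𝟏≤op c (contradictory x y))
    , (λ x y → contradictory⇒𝟏≤op c (contradictory-sym (contradictory x y)))
    where
    𝟏≤∼op[x,∼x] : ∀ x → 𝟏 ≤ ∼ op c A x (∼ x)
    𝟏≤∼op[x,∼x] x = 𝟏≤∼∼∼x⇒𝟏≤∼x (subst (λ z → 𝟏 ≤ ∼ ∼ ∼ z) (⟦⇒⟧ c p (¬ᶠ p) v)
      (glivenko (¬ᶠ (p ⇒[ c ] ¬ᶠ p)) (¬[p⇒¬p]-tautology c) v))
      where v = λ _ → x
    𝟏≤∼op[∼x,x] : ∀ x → 𝟏 ≤ ∼ op c A (∼ x) x
    𝟏≤∼op[∼x,x] x = 𝟏≤∼∼∼x⇒𝟏≤∼x (subst (λ z → 𝟏 ≤ ∼ ∼ ∼ z) (⟦⇒⟧ c (¬ᶠ p) p v)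
      (glivenko (¬ᶠ (¬ᶠ p ⇒[ c ] p)) (¬[¬p⇒p]-tautology c) v))
      where v = λ _ → x
    contradictory : OpsContradictory c
    contradictory x y =
        𝟏≤∼∼∼x⇒x≤𝟎 (subst₂ (λ a b → 𝟏 ≤ ∼ ∼ ∼ (a ∙ b)) (⟦⇒⟧ c p q v) (⟦⇒⟧ c p (¬ᶠ q) v)
          (glivenko (¬ᶠ ((p ⇒[ c ] q) ·ᶠ (p ⇒[ c ] ¬ᶠ q))) (contrary-tautology c) v))
      , 𝟏≤∼∼∼x⇒x≤𝟎 (subst₂ (λ b a → 𝟏 ≤ ∼ ∼ ∼ (∼ b ∙ ∼ a)) (⟦⇒⟧ c p (¬ᶠ q) v) (⟦⇒⟧ c p q v)
          (glivenko (¬ᶠ (¬ᶠ (p ⇒[ c ] ¬ᶠ q) ·ᶠ ¬ᶠ (p ⇒[ c ] q))) (subcontrary-tautology c) v))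
      where v = assign x y

  validBoethius⇒boethiusAlg :
    ∀ c → (∀ φ ψ → Valid A ((φ ⇒[ c ] ψ) ⇒[ c ] ¬ᶠ (φ ⇒[ c ] ¬ᶠ ψ)))
        ⊎ (∀ φ ψ → Valid A ((φ ⇒[ c ] ¬ᶠ ψ) ⇒[ c ] ¬ᶠ (φ ⇒[ c ] ψ))) → BoethiusAlg c
  validBoethius⇒boethiusAlg c = Sum.map
    (λ thesis x y → subst (𝟏 ≤_) (⟦boethius⟧ c p q (¬ᶠ q) (assign x y)) (thesis p q (assign x y)))
    (λ thesis x y → subst (𝟏 ≤_) (⟦boethius⟧ c p (¬ᶠ q) q (assign x y)) (thesis p q (assign x y)))

  protoConnAlg⇒validBoethius : ∀ c → ProtoConnAlg A (op c A) →
                               ∀ φ ψ → Valid A ((φ ⇒[ c ] ψ) ⇒[ c ] ¬ᶠ (φ ⇒[ c ] ¬ᶠ ψ))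
  protoConnAlg⇒validBoethius c (_ , _ , thesis , _) φ ψ v =
    subst (𝟏 ≤_) (sym (⟦boethius⟧ c φ ψ (¬ᶠ ψ) v)) (thesis _ _)

-- The Glivenko logic of CPL

DoubleNegatedTautologies : Axioms
DoubleNegatedTautologies φ = Σ Formula λ ψ → (φ ≡ ¬ᶠ (¬ᶠ ψ)) × Tautology ψ

satisfiesGlivenko⇒inV : ∀ A → SatisfiesGlivenko A → InV DoubleNegatedTautologies A
satisfiesGlivenko⇒inV A glivenko _ (ψ , refl , taut) = glivenko ψ taut

tautology⇒cpl : ∀ ψ → Tautology ψ → ⊢CPL ψ
tautology⇒cpl ψ taut A isBoolean = FLeProperties.Boolean.tautology⇒valid A isBoolean ψ taut

doubleNegatedTautologies-isGlivenkoCPL : IsGlivenkoCPL DoubleNegatedTautologies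
doubleNegatedTautologies-isGlivenkoCPL = glivenko , least
  where
  glivenko : GlivenkoCPL DoubleNegatedTautologies
  glivenko φ = mk⇔
    (λ ⊢φ A A∈V → A∈V (¬ᶠ (¬ᶠ φ)) (φ , refl , ⊢φ B₂ B₂-isBoolean))
    (λ ⊢¬¬φ A isBoolean v → let open FLeProperties A; open Boolean isBoolean in
      ≤-trans (⊢¬¬φ A (satisfiesGlivenko⇒inV A (Kalmar.satisfiesGlivenko isGlivenkoAlgebra)) v) ∼∼x≤x)
  least : ∀ K → GlivenkoCPL K → DoubleNegatedTautologies ⊆ᴸ K
  least K glivenkoK φ ⊢φ A A∈K = ⊢φ A (satisfiesGlivenko⇒inV A λ ψ taut →
    Equivalence.to (glivenkoK ψ) (tautology⇒cpl ψ taut) A A∈K)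

extendsGCPL⇔satisfiesGlivenko : ∀ L → ExtendsGCPL L ⇔ (∀ A → InV L A → SatisfiesGlivenko A)
extendsGCPL⇔satisfiesGlivenko L = mk⇔
  (λ { (G , (glivenkoG , _) , G⊆L) A A∈L ψ taut →
         G⊆L (¬ᶠ (¬ᶠ ψ)) (Equivalence.to (glivenkoG ψ) (tautology⇒cpl ψ taut)) A A∈L })
  (λ glivenko → DoubleNegatedTautologies , doubleNegatedTautologies-isGlivenkoCPL ,
                λ φ ⊢φ A A∈L → ⊢φ A (satisfiesGlivenko⇒inV A (glivenko A A∈L)))

data Three : Set where
  bot mid top : Three

infixl 6 _⊓₃_ _⊔₃_
infixr 5 _→₃_

_⊓₃_ : Three → Three → Three
bot ⊓₃ _   = bot
mid ⊓₃ bot = bot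
mid ⊓₃ _   = mid
top ⊓₃ y   = y

_⊔₃_ : Three → Three → Three
bot ⊔₃ y   = y
mid ⊔₃ top = top
mid ⊔₃ _   = mid
top ⊔₃ _   = top

_→₃_ : Three → Three → Three
bot →₃ _   = top
mid →₃ bot = bot
mid →₃ _   = top
top →₃ y   = y

⊓₃-comm : ∀ x y → x ⊓₃ y ≡ y ⊓₃ x
⊓₃-comm bot bot = refl
⊓₃-comm bot mid = refl
⊓₃-comm bot top = refl
⊓₃-comm mid bot = refl
⊓₃-comm mid mid = refl
⊓₃-comm mid top = refl
⊓₃-comm top bot = refl
⊓₃-comm top mid = refl
⊓₃-comm top top = refl

⊔₃-comm : ∀ x y → x ⊔₃ y ≡ y ⊔₃ x
⊔₃-comm bot bot = refl
⊔₃-comm bot mid = refl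
⊔₃-comm bot top = refl
⊔₃-comm mid bot = refl
⊔₃-comm mid mid = refl
⊔₃-comm mid top = refl
⊔₃-comm top bot = refl
⊔₃-comm top mid = refl
⊔₃-comm top top = refl

⊓₃-assoc : ∀ x y z → x ⊓₃ y ⊓₃ z ≡ x ⊓₃ (y ⊓₃ z)
⊓₃-assoc bot _   _   = refl
⊓₃-assoc mid bot _   = refl
⊓₃-assoc mid mid bot = refl
⊓₃-assoc mid mid mid = refl
⊓₃-assoc mid mid top = refl
⊓₃-assoc mid top _   = refl
⊓₃-assoc top _   _   = refl

⊔₃-assoc : ∀ x y z → x ⊔₃ y ⊔₃ z ≡ x ⊔₃ (y ⊔₃ z)
⊔₃-assoc bot _   _   = refl
⊔₃-assoc mid bot _   = refl
⊔₃-assoc mid mid bot = refl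
⊔₃-assoc mid mid mid = refl
⊔₃-assoc mid mid top = refl
⊔₃-assoc mid top _   = refl
⊔₃-assoc top _   _   = refl

⊓₃-absorbs-⊔₃ : ∀ x y → x ⊓₃ (x ⊔₃ y) ≡ x
⊓₃-absorbs-⊔₃ bot _   = refl
⊓₃-absorbs-⊔₃ mid bot = refl
⊓₃-absorbs-⊔₃ mid mid = refl
⊓₃-absorbs-⊔₃ mid top = refl
⊓₃-absorbs-⊔₃ top _   = refl

⊔₃-absorbs-⊓₃ : ∀ x y → x ⊔₃ (x ⊓₃ y) ≡ x
⊔₃-absorbs-⊓₃ bot _   = refl
⊔₃-absorbs-⊓₃ mid bot = refl
⊔₃-absorbs-⊓₃ mid mid = refl
⊔₃-absorbs-⊓₃ mid top = refl
⊔₃-absorbs-⊓₃ top _   = refl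

⊓₃-identityˡ : ∀ x → top ⊓₃ x ≡ x
⊓₃-identityˡ _ = refl

residuated₃ : ∀ x y z → (x ⊓₃ y ⊓₃ z ≡ x ⊓₃ y) ⇔ (x ⊓₃ (y →₃ z) ≡ x)
residuated₃ bot _   _   = mk⇔ id id
residuated₃ mid bot _   = mk⇔ (λ _ → refl) (λ _ → refl)
residuated₃ mid mid bot = mk⇔ id id
residuated₃ mid mid mid = mk⇔ id id
residuated₃ mid mid top = mk⇔ id id
residuated₃ mid top _   = mk⇔ id id
residuated₃ top bot _   = mk⇔ (λ _ → refl) (λ _ → refl)
residuated₃ top mid bot = mk⇔ (λ ()) (λ ())
residuated₃ top mid mid = mk⇔ (λ _ → refl) (λ _ → refl)
residuated₃ top mid top = mk⇔ (λ _ → refl) (λ _ → refl)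
residuated₃ top top _   = mk⇔ id id

G₃ : FLe
G₃ = record
  { Carrier = Three
  ; _⊓_ = _⊓₃_ ; _⊔_ = _⊔₃_ ; _∙_ = _⊓₃_ ; _↝_ = _→₃_ ; zero = bot ; one = top
  ; ⊓-comm = ⊓₃-comm ; ⊔-comm = ⊔₃-comm ; ⊓-assoc = ⊓₃-assoc ; ⊔-assoc = ⊔₃-assoc
  ; ⊓-absorbs-⊔ = ⊓₃-absorbs-⊔₃ ; ⊔-absorbs-⊓ = ⊔₃-absorbs-⊓₃
  ; ∙-assoc = ⊓₃-assoc ; ∙-comm = ⊓₃-comm ; ∙-identityˡ = ⊓₃-identityˡ
  ; residuated = residuated₃
  }

G₃-isHeyting : IsHeyting G₃
G₃-isHeyting = (λ _ _ → refl) , λ _ → refl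

op-G₃-noncommutative : ∀ c → op c G₃ mid top ≢ op c G₃ top mid
op-G₃-noncommutative wedge ()
op-G₃-noncommutative circ  ()

noncommutative-in-V : ∀ L c → ⊆IPL L → Σ FLe λ A → InV L A × ∃[ x ] ∃[ y ] (op c A x y ≢ op c A y x)
noncommutative-in-V L c L⊆IPL = G₃ , G₃∈V , mid , top , op-G₃-noncommutative c
  where
  G₃∈V : InV L G₃
  G₃∈V φ φ∈L = L⊆IPL φ (λ A A∈L → A∈L φ φ∈L) G₃ G₃-isHeyting

protoConnexive⇒boethius : ∀ L c → ProtoConnexive L c → Boethius L c
protoConnexive⇒boethius L c proto =
  inj₁ λ φ ψ A A∈L → ConnexiveAlgebra.protoConnAlg⇒validBoethius A c (proto A A∈L) φ ψ

boethius⇒boethiusAlg : ∀ L c → Boethius L c → ∀ A → InV L A → ConnexiveAlgebra.BoethiusAlg A c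
boethius⇒boethiusAlg L c boethius A A∈L = ConnexiveAlgebra.validBoethius⇒boethiusAlg A c
  (Sum.map (λ thesis φ ψ → thesis φ ψ A A∈L) (λ thesis φ ψ → thesis φ ψ A A∈L) boethius)

boethius∧⇒satisfiesGlivenko : ∀ L → Boethius L wedge → ∀ A → InV L A → SatisfiesGlivenko A
boethius∧⇒satisfiesGlivenko L boethius A A∈L =
  Kalmar.satisfiesGlivenko (opsContradictory⇒isGlivenkoAlgebra x∙𝟎≤𝟎 wedge contradictory)
  where
  open FLeProperties A
  open ConnexiveAlgebra A
  contradictory : OpsContradictory wedge
  contradictory = boethiusAlg⇒opsContradictory wedge 𝟏≤op∧⇒contradictory
    (boethius⇒boethiusAlg L wedge boethius A A∈L)
  x∙𝟎≤𝟎 : ∀ x → x ∙ 𝟎 ≤ 𝟎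
  x∙𝟎≤𝟎 = opsContradictory∧⇒x∙𝟎≤𝟎 contradictory

boethius∘⇒satisfiesGlivenko : ∀ L → (∀ φ → ⊢[ L ] (φ ⟶ᶠ ¬ᶠ (¬ᶠ 𝟙ᶠ))) →
                              Boethius L circ → ∀ A → InV L A → SatisfiesGlivenko A
boethius∘⇒satisfiesGlivenko L ⊢φ⟶¬¬𝟙 boethius A A∈L =
  Kalmar.satisfiesGlivenko (opsContradictory⇒isGlivenkoAlgebra x∙𝟎≤𝟎 circ contradictory)
  where
  open FLeProperties A
  open ConnexiveAlgebra A
  x∙𝟎≤𝟎 : ∀ x → x ∙ 𝟎 ≤ 𝟎
  x∙𝟎≤𝟎 = x≤∼∼𝟏⇒x∙𝟎≤𝟎 λ x → 𝟏≤↝⇒≤ (⊢φ⟶¬¬𝟙 p A A∈L (λ _ → x))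
  contradictory : OpsContradictory circ
  contradictory = boethiusAlg⇒opsContradictory circ (𝟏≤op⇒contradictory x∙𝟎≤𝟎 circ)
    (boethius⇒boethiusAlg L circ boethius A A∈L)

tfae : ∀ L c → ⊆IPL L → (Boethius L c → ∀ A → InV L A → SatisfiesGlivenko A) → TFAE L c
tfae L c L⊆IPL boethius⇒glivenko =
    mk⇔ (boethius⇒extends ∘ protoConnexive⇒boethius L c ∘ proj₁)
        (λ extends → extends⇒protoConnexive extends , noncommutative-in-V L c L⊆IPL)
  , mk⇔ (boethius⇒extends ∘ protoConnexive⇒boethius L c) extends⇒protoConnexive
  , mk⇔ boethius⇒extends (protoConnexive⇒boethius L c ∘ extends⇒protoConnexive)
  where
  boethius⇒extends : Boethius L c → ExtendsGCPL L
  boethius⇒extends = Equivalence.from (extendsGCPL⇔satisfiesGlivenko L) ∘ boethius⇒glivenko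
  extends⇒protoConnexive : ExtendsGCPL L → ProtoConnexive L c
  extends⇒protoConnexive extends A A∈L = ConnexiveAlgebra.satisfiesGlivenko⇒protoConnAlg A
    (Equivalence.to (extendsGCPL⇔satisfiesGlivenko L) extends A A∈L) c

theorem3p28 : (∀ (L : Axioms) → ⊆IPL L → TFAE L wedge)
    × (∀ (L : Axioms) → ⊆IPL L → (∀ φ → ⊢[ L ] (φ ⟶ᶠ ¬ᶠ (¬ᶠ 𝟙ᶠ))) → TFAE L circ)
theorem3p28 =
    (λ L L⊆IPL → tfae L wedge L⊆IPL (boethius∧⇒satisfiesGlivenko L))
  , (λ L L⊆IPL ⊢φ⟶¬¬𝟙 → tfae L circ L⊆IPL (boethius∘⇒satisfiesGlivenko L ⊢φ⟶¬¬𝟙))
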